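{- If a complete theory $T$ has a witness of $\mathrm{SSOP}_1$, then $T$ has an antichain tree.
   Context: In ${}^{\omega>}2$: $\unlhd$ initial segment, $^\frown$ concatenation. A witness of $\mathrm{SSOP}_1$ is a pair $\langle\varphi(x,y),\langle a_\eta\rangle_{\eta\in{}^{\omega>}2}\rangle$ in the monster model of $T$ such that for all $X\subseteq{}^{\omega>}2$, $\{\varphi(x,a_\eta):\eta\in X\}$ is consistent iff there are no $\eta,\nu\in{}^{\omega>}2$ with $\eta^\frown\langle1\rangle\in X$ and $\eta^\frown\langle0\rangle^\frown\nu\in X$. An antichain tree is a pair $\langle\varphi(x,y),\langle b_\eta\rangle_{\eta\in{}^{\omega>}2}\rangle$ such that for all $X\subseteq{}^{\omega>}2$, $\{\varphi(x,b_\eta):\eta\in X\}$ is consistent iff the elements of $X$ are pairwise $\unlhd$-incomparable. -}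

module Defs where

open import Data.Nat using (ℕ; suc; _+_)
open import Data.Fin using (Fin; zero; suc)
open import Data.Bool using (Bool; true; false)
open import Data.List using (List; []; _∷_; _++_)
open import Data.List.Relation.Unary.All using (All)
open import Data.Vec.Functional using (Vector) renaming (_++_ to _⧺_)
open import Data.Product using (Σ; ∃; ∃-syntax; _×_)
open import Data.Sum using (_⊎_)
open import Data.Empty using (⊥)
open import Relation.Binary.PropositionalEquality using (_≡_)
open import Relation.Nullary using (¬_)
open import Function.Bundles using (_⇔_)

-- First-order logic (single-sorted), formulas in de Bruijn style:
-- Formula k = formulas whose free variables are among 0 .. k-1.

record Language : Set₁ where
  field
    Func : ℕ → Set
    Rel  : ℕ → Set
open Language public

module _ (L : Language) where

  data Term (k : ℕ) : Set where
    var  : Fin k → Term k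
    func : ∀ {r} → Func L r → Vector (Term k) r → Term k

  data Formula : ℕ → Set where
    ⊥'   : ∀ {k} → Formula k
    _≐_  : ∀ {k} → Term k → Term k → Formula k
    rel  : ∀ {k r} → Rel L r → Vector (Term k) r → Formula k
    _⇒_  : ∀ {k} → Formula k → Formula k → Formula k
    _∧'_ : ∀ {k} → Formula k → Formula k → Formula k
    _∨'_ : ∀ {k} → Formula k → Formula k → Formula k
    ∀'   : ∀ {k} → Formula (suc k) → Formula k
    ∃'   : ∀ {k} → Formula (suc k) → Formula k

  Sentence : Set
  Sentence = Formula 0

  ¬' : ∀ {k} → Formula k → Formula k
  ¬' φ = φ ⇒ ⊥'

  Theory : Set₁
  Theory = Sentence → Set

  record Structure : Set₁ where
    field
      Carrier : Set
      point   : Carrier            -- structures are nonempty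
      funᴹ    : ∀ {r} → Func L r → Vector Carrier r → Carrier
      relᴹ    : ∀ {r} → Rel L r → Vector Carrier r → Set
  open Structure public

  module _ (M : Structure) where
    evalT : ∀ {k} → Term k → Vector (Carrier M) k → Carrier M
    evalT (var i) ρ = ρ i
    evalT (func f ts) ρ = funᴹ M f (λ i → evalT (ts i) ρ)

    evalTs : ∀ {k r} → Vector (Term k) r → Vector (Carrier M) k → Vector (Carrier M) r
    evalTs ts ρ i = evalT (ts i) ρ

    cons : ∀ {k} → Carrier M → Vector (Carrier M) k → Vector (Carrier M) (suc k)
    cons c ρ zero = c
    cons c ρ (suc i) = ρ i

    Sat : ∀ {k} → Formula k → Vector (Carrier M) k → Set
    Sat ⊥' ρ = ⊥
    Sat (s ≐ t) ρ = evalT s ρ ≡ evalT t ρ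
    Sat (rel R ts) ρ = relᴹ M R (evalTs ts ρ)
    Sat (φ ⇒ ψ) ρ = Sat φ ρ → Sat ψ ρ
    Sat (φ ∧' ψ) ρ = Sat φ ρ × Sat ψ ρ
    Sat (φ ∨' ψ) ρ = Sat φ ρ ⊎ Sat ψ ρ
    Sat (∀' φ) ρ = (c : Carrier M) → Sat φ (cons c ρ)
    Sat (∃' φ) ρ = Σ (Carrier M) λ c → Sat φ (cons c ρ)

    SatS : Sentence → Set
    SatS σ = Sat σ (λ ())

  Model : Structure → Theory → Set
  Model M T = ∀ σ → T σ → SatS M σ

  Complete : Theory → Set₁
  Complete T = (Σ Structure λ M → Model M T)
             × (∀ σ → (∀ M → Model M T → SatS M σ) ⊎ (∀ M → Model M T → SatS M (¬' σ)))

-- The binary tree ^{ω>}2 : finite lists of booleans (false = 0, true = 1)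

Tree : Set
Tree = List Bool

_⊴_ : Tree → Tree → Set
η ⊴ ν = ∃[ ρ ] (η ++ ρ ≡ ν)

Incomparable : Tree → Tree → Set
Incomparable η ν = ¬ (η ⊴ ν) × ¬ (ν ⊴ η)

-- Parameters live in a model M of
-- the complete theory; the partial type is consistent (realised in the
-- monster model) iff it is finitely satisfiable in M (compactness).

module _ {L : Language} (M : Structure L) {n m : ℕ} (φ : Formula L (n + m)) where

  Realised : (Tree → Vector (Carrier M) m) → List Tree → Set
  Realised a Ls = Σ (Vector (Carrier M) n) λ c → All (λ η → Sat L M φ (c ⧺ a η)) Ls

  Consistent : (Tree → Vector (Carrier M) m) → (Tree → Set) → Set
  Consistent a X = (Ls : List Tree) → All X Ls → Realised a Ls

  SSOP1Witness : (Tree → Vector (Carrier M) m) → Set₁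
  SSOP1Witness a = (X : Tree → Set) →
    Consistent a X ⇔
      (¬ (Σ Tree λ η → Σ Tree λ ν → X (η ++ (true ∷ [])) × X (η ++ (false ∷ ν))))

  AntichainTree : (Tree → Vector (Carrier M) m) → Set₁
  AntichainTree b = (X : Tree → Set) →
    Consistent b X ⇔ (∀ η ν → X η → X ν → ¬ (η ≡ ν) → Incomparable η ν)

-- T has a witness of SSOP₁: in some (equivalently, by completeness and
-- compactness, the monster) model of T.
HasSSOP1Witness : (L : Language) → Theory L → Set₁
HasSSOP1Witness L T = Σ (Structure L) λ M → Model L M T × Σ ℕ λ n → Σ ℕ λ m →
  Σ (Formula L (n + m)) λ φ → Σ (Tree → Vector (Carrier M) m) λ a → SSOP1Witness M φ a

HasAntichainTree : (L : Language) → Theory L → Set₁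
HasAntichainTree L T = Σ (Structure L) λ M → Model L M T × Σ ℕ λ n → Σ ℕ λ m →
  Σ (Formula L (n + m)) λ φ → Σ (Tree → Vector (Carrier M) m) λ b → AntichainTree M φ b

-- Let spread η insert a 0 before every digit of η, and embed η = spread η ⌢ 1.
-- Then embed η and embed ν are of the form ρ⌢1, ρ⌢0⌢μ exactly when η is a
-- proper initial segment of ν.  So a subset X of the tree is an antichain iff
-- its image under embed avoids the pattern forbidden by SSOP₁, and reindexing
-- an SSOP₁ witness along embed, b_η = a_{embed η}, gives an antichain tree.
module Submission where

open import Defs
open import Data.Nat using (ℕ; _+_)
open import Data.Bool using (true; false)
open import Data.List using (List; []; _∷_; _++_; map)
open import Data.List.Relation.Unary.All as All using (All; []; _∷_)
open import Data.List.Relation.Unary.All.Properties using (map⁺; map⁻)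
open import Data.List.Properties using (∷-injective; ∷-injectiveʳ; ∷ʳ-injectiveˡ; ++-assoc; ++-identityʳ)
open import Data.Vec.Functional using (Vector)
open import Data.Empty using (⊥-elim)
open import Data.Product using (Σ; ∃-syntax; _×_; _,_)
open import Function using (_∘_)
open import Function.Bundles using (_⇔_; mk⇔)
open import Function.Properties.Equivalence using () renaming (trans to ⇔-trans)
open import Relation.Binary.PropositionalEquality using (_≡_; _≢_; refl; sym; trans; cong; cong₂; module ≡-Reasoning)
open import Relation.Nullary using (¬_)

_⊲_ : Tree → Tree → Set
η ⊲ ν = η ⊴ ν × η ≢ ν

Forks : Tree → Tree → Set
Forks s t = Σ Tree λ ρ → Σ Tree λ μ → s ≡ ρ ++ true ∷ [] × t ≡ ρ ++ false ∷ μ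

HasFork : (Tree → Set) → Set
HasFork X = Σ Tree λ η → Σ Tree λ ν → X (η ++ true ∷ []) × X (η ++ false ∷ ν)

Antichain : (Tree → Set) → Set
Antichain X = ∀ η ν → X η → X ν → η ≢ ν → Incomparable η ν

Image : (Tree → Tree) → (Tree → Set) → Tree → Set
Image h X t = Σ Tree λ η → X η × h η ≡ t

spread : Tree → Tree
spread [] = []
spread (i ∷ η) = false ∷ i ∷ spread η

embed : Tree → Tree
embed η = spread η ++ true ∷ []

spread-++ : ∀ η κ → spread (η ++ κ) ≡ spread η ++ spread κ
spread-++ []      κ = refl
spread-++ (i ∷ η) κ = cong (λ s → false ∷ i ∷ s) (spread-++ η κ)

spread-fork⇒⊲ : ∀ η ν μ → spread ν ++ true ∷ [] ≡ spread η ++ false ∷ μ → η ⊲ ν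
spread-fork⇒⊲ []      []      μ ()
spread-fork⇒⊲ []      (j ∷ ν) μ e = (j ∷ ν , refl) , λ ()
spread-fork⇒⊲ (i ∷ η) []      μ ()
spread-fork⇒⊲ (i ∷ η) (j ∷ ν) μ e with ∷-injective (∷-injectiveʳ e)
... | j≡i , e′ with spread-fork⇒⊲ η ν μ e′
... | (κ , η++κ≡ν) , η≢ν = (κ , cong₂ _∷_ (sym j≡i) η++κ≡ν) , η≢ν ∘ ∷-injectiveʳ

embed-forks⇒⊲ : ∀ η ν → Forks (embed η) (embed ν) → η ⊲ ν
embed-forks⇒⊲ η ν (ρ , μ , eη , eν) =
  spread-fork⇒⊲ η ν μ (trans eν (cong (_++ false ∷ μ) (sym (∷ʳ-injectiveˡ (spread η) ρ eη))))

⊲⇒embed-forks : ∀ η ν → η ⊲ ν → Forks (embed η) (embed ν)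
⊲⇒embed-forks η ν (([] , η++[]≡ν) , η≢ν) = ⊥-elim (η≢ν (trans (sym (++-identityʳ η)) η++[]≡ν))
⊲⇒embed-forks η ._ ((i ∷ κ , refl) , _) = spread η , i ∷ spread κ ++ true ∷ [] , refl , embed-split
  where
  open ≡-Reasoning
  embed-split : embed (η ++ i ∷ κ) ≡ spread η ++ false ∷ i ∷ spread κ ++ true ∷ []
  embed-split = begin
    spread (η ++ i ∷ κ) ++ true ∷ []            ≡⟨ cong (_++ true ∷ []) (spread-++ η (i ∷ κ)) ⟩
    (spread η ++ spread (i ∷ κ)) ++ true ∷ []   ≡⟨ ++-assoc (spread η) (spread (i ∷ κ)) (true ∷ []) ⟩
    spread η ++ false ∷ i ∷ spread κ ++ true ∷ [] ∎

All-Image⇒map : ∀ {h : Tree → Tree} {X : Tree → Set} (ts : List Tree) →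
                All (Image h X) ts → ∃[ ηs ] All X ηs × map h ηs ≡ ts
All-Image⇒map []       []                     = [] , [] , refl
All-Image⇒map (_ ∷ ts) ((η , Xη , refl) ∷ ps) with All-Image⇒map ts ps
... | ηs , Xηs , refl = η ∷ ηs , Xη ∷ Xηs , refl

All⇒All-Image : ∀ {h : Tree → Tree} {X : Tree → Set} {ηs : List Tree} →
                All X ηs → All (Image h X) (map h ηs)
All⇒All-Image = map⁺ ∘ All.map (λ {η} Xη → η , Xη , refl)

image-forkFree⇔antichain : (X : Tree → Set) → (¬ HasFork (Image embed X)) ⇔ Antichain X
image-forkFree⇔antichain X = mk⇔ antichain forkFree
  where
  fork : ∀ {η ν} → X η → X ν → η ⊲ ν → HasFork (Image embed X)
  fork {η} {ν} Xη Xν η⊲ν with ⊲⇒embed-forks η ν η⊲ν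
  ... | ρ , μ , eη , eν = ρ , μ , (η , Xη , eη) , (ν , Xν , eν)

  antichain : ¬ HasFork (Image embed X) → Antichain X
  antichain noFork η ν Xη Xν η≢ν =
    (λ η⊴ν → noFork (fork Xη Xν (η⊴ν , η≢ν))) ,
    (λ ν⊴η → noFork (fork Xν Xη (ν⊴η , η≢ν ∘ sym)))

  forkFree : Antichain X → ¬ HasFork (Image embed X)
  forkFree ac (ρ , μ , (η , Xη , eη) , (ν , Xν , eν))
    with embed-forks⇒⊲ η ν (ρ , μ , eη , eν)
  ... | η⊴ν , η≢ν with ac η ν Xη Xν η≢ν
  ... | ¬η⊴ν , _ = ¬η⊴ν η⊴ν

module _ {L : Language} (M : Structure L) {n m : ℕ} (φ : Formula L (n + m))
         (a : Tree → Vector (Carrier M) m) where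

  consistent-reindex⇔ : (h : Tree → Tree) (X : Tree → Set) →
                        Consistent M φ (a ∘ h) X ⇔ Consistent M φ a (Image h X)
  consistent-reindex⇔ h X = mk⇔ pushforward pullback
    where
    pushforward : Consistent M φ (a ∘ h) X → Consistent M φ a (Image h X)
    pushforward con ts ps with All-Image⇒map ts ps
    ... | ηs , Xηs , refl with con ηs Xηs
    ... | c , sat = c , map⁺ sat

    pullback : Consistent M φ a (Image h X) → Consistent M φ (a ∘ h) X
    pullback con ηs Xηs with con (map h ηs) (All⇒All-Image Xηs)
    ... | c , sat = c , map⁻ sat

  SSOP1Witness⇒AntichainTree : SSOP1Witness M φ a → AntichainTree M φ (a ∘ embed)
  SSOP1Witness⇒AntichainTree W X =
    ⇔-trans (consistent-reindex⇔ embed X)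
      (⇔-trans (W (Image embed X)) (image-forkFree⇔antichain X))

proposition5p6 : (L : Language) (T : Theory L) → Complete L T →
    HasSSOP1Witness L T → HasAntichainTree L T
proposition5p6 L T _ (M , M⊨T , n , m , φ , a , W) =
  M , M⊨T , n , m , φ , a ∘ embed , SSOP1Witness⇒AntichainTree M φ a W
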